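{- Let $P=(P_{i,j})_{i,j\ge 0}$ be the infinite integer matrix, with rows and columns indexed by non-negative integers, defined by $P_{i,j}=1$ if $\binom{i+j}{i}$ is odd and $P_{i,j}=0$ if it is even. For integers $n,m\ge 0$ let $P_m(n)$ denote the $n\times n$ sub-matrix of $P$ formed by the rows indexed $0,1,\dots,n-1$ and the columns indexed $m,m+1,\dots,m+n-1$. Then for all $n,m\ge 0$, the determinant of $P_m(n)$, computed in $\mathbb{Z}$, equals $1$ or $-1$.
   Context: The empty ($n=0$) determinant is $1$. -}

module Defs where

open import Data.Nat as ℕ using (ℕ; zero; suc; _%_)
open import Data.Nat.Combinatorics using (_C_)
open import Data.Fin using (Fin; zero; suc; toℕ; punchIn)
open import Data.Integer as ℤ using (ℤ; +_; -_)
open import Data.Bool using (if_then_else_)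
open import Relation.Nullary.Decidable using (⌊_⌋)

Matrix : ℕ → Set
Matrix n = Fin n → Fin n → ℤ

sumFin : ∀ {n} → (Fin n → ℤ) → ℤ
sumFin {zero}  f = + 0
sumFin {suc n} f = f zero ℤ.+ sumFin (λ i → f (suc i))

sign : ℕ → ℤ
sign zero = + 1
sign (suc k) = - sign k

minor : ∀ {n} → Matrix (suc n) → Fin (suc n) → Matrix n
minor A j r c = A (suc r) (punchIn j c)

det : ∀ {n} → Matrix n → ℤ
det {zero}  A = + 1
det {suc n} A = sumFin (λ j → sign (toℕ j) ℤ.* (A zero j ℤ.* det (minor A j)))

P : ℕ → ℕ → ℤ
P i j = if ⌊ ((i ℕ.+ j) C i) % 2 ℕ.≟ 1 ⌋ then + 1 else + 0

Psub : ℕ → (n : ℕ) → Matrix n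
Psub m n r c = P (toℕ r) (m ℕ.+ toℕ c)

{-# OPTIONS --safe #-}
module Submission where

-- By Lucas' theorem modulo 2, P (2i) (2j) = P (2i) (2j+1) = P (2i+1) (2j) = P i j and
-- P (2i+1) (2j+1) = 0.  Subtracting row 2i+1 from row 2i of P_m(n), for every such pair of
-- rows, does not change the determinant; afterwards the differenced even rows vanish in the
-- columns of even index in P, and the odd rows in those of odd index.  Splitting rows and
-- columns into these classes exhibits a zero block, so the determinant is, up to sign, the
-- product of the determinants of two submatrices of the form P_m'(⌊n/2⌋) and P_m''(⌈n/2⌉),
-- and induction on n gives |det P_m(n)| = 1.  The block factorisation is a Laplace expansion
-- along an interleaving of the rows, proved by expanding along the first row.

open import Defs
open import Function using (_∘_)
open import Data.Bool using (Bool; true; false; _xor_)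
open import Data.Bool.Properties using (xor-same; xor-identityʳ)
open import Data.Nat as ℕ using (ℕ; zero; suc; z≤n; s≤s; _%_; ⌊_/2⌋)
import Data.Nat.Properties as ℕP
open import Data.Nat.DivMod using (%-distribˡ-+)
open import Data.Nat.Combinatorics using (_C_; nCn≡1; nCk+nC[k+1]≡[n+1]C[k+1])
open import Data.Nat.Induction using (<-rec)
import Data.Nat.Tactic.RingSolver as ℕSolver
open import Data.Integer using (ℤ; +_; -[1+_]; -_; _+_; _*_; _-_; ∣_∣)
import Data.Integer.Properties as ℤP
import Data.Integer.Tactic.RingSolver as ℤSolver
open import Data.Fin using (Fin; zero; suc; toℕ; punchIn)
open import Data.Sum using (_⊎_; inj₁; inj₂)
open import Relation.Binary.PropositionalEquality
open import Algebra.Properties.AbelianGroup ℤP.+-0-abelianGroup using (∙-cancelˡ)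
import Algebra.Properties.CommutativeSemigroup as CommutativeSemigroupProperties
open CommutativeSemigroupProperties ℤP.+-commutativeSemigroup
  using () renaming (interchange to +-interchange; x∙yz≈y∙xz to +-x∙yz≈y∙xz)
open CommutativeSemigroupProperties ℤP.*-commutativeSemigroup
  using () renaming (x∙yz≈y∙xz to *-x∙yz≈y∙xz)
open CommutativeSemigroupProperties ℕP.+-commutativeSemigroup
  using () renaming (x∙yz≈y∙xz to ℕ+-x∙yz≈y∙xz)
open ≡-Reasoning

sumFin-cong : ∀ {n} {f g : Fin n → ℤ} → (∀ i → f i ≡ g i) → sumFin f ≡ sumFin g
sumFin-cong {zero}  f≗g = refl
sumFin-cong {suc n} f≗g = cong₂ _+_ (f≗g zero) (sumFin-cong (f≗g ∘ suc))

sumFin-zero : ∀ {n} {f : Fin n → ℤ} → (∀ i → f i ≡ + 0) → sumFin f ≡ + 0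
sumFin-zero {zero}  f≗0 = refl
sumFin-zero {suc n} f≗0 = cong₂ _+_ (f≗0 zero) (sumFin-zero (f≗0 ∘ suc))

sumFin-*ˡ : ∀ {n} c (f : Fin n → ℤ) → sumFin (λ i → c * f i) ≡ c * sumFin f
sumFin-*ˡ {zero}  c f = sym (ℤP.*-zeroʳ c)
sumFin-*ˡ {suc n} c f = trans (cong (_+_ (c * f zero)) (sumFin-*ˡ c (f ∘ suc)))
                              (sym (ℤP.*-distribˡ-+ c (f zero) _))

sumFin-+ : ∀ {n} (f g : Fin n → ℤ) → sumFin (λ i → f i + g i) ≡ sumFin f + sumFin g
sumFin-+ {zero}  f g = refl
sumFin-+ {suc n} f g = trans (cong (_+_ (f zero + g zero)) (sumFin-+ (f ∘ suc) (g ∘ suc)))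
                             (+-interchange (f zero) (g zero) _ _)

sumFin-neg : ∀ {n} (f : Fin n → ℤ) → sumFin (λ i → - f i) ≡ - sumFin f
sumFin-neg {zero}  f = refl
sumFin-neg {suc n} f = trans (cong (_+_ (- f zero)) (sumFin-neg (f ∘ suc)))
                             (sym (ℤP.neg-distrib-+ (f zero) _))

sumFin-comm : ∀ {m n} (H : Fin m → Fin n → ℤ) →
              sumFin (λ i → sumFin (H i)) ≡ sumFin (λ j → sumFin (λ i → H i j))
sumFin-comm {zero} {n} H = sym (sumFin-zero {n} (λ _ → refl))
sumFin-comm {suc m} H = trans (cong (_+_ (sumFin (H zero))) (sumFin-comm (H ∘ suc)))
                              (sym (sumFin-+ (H zero) (λ j → sumFin (λ i → H (suc i) j))))

sumFin-punchIn : ∀ {n} (f : Fin (suc n) → ℤ) j → sumFin f ≡ f j + sumFin (f ∘ punchIn j)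
sumFin-punchIn f zero = refl
sumFin-punchIn {suc n} f (suc j) = trans (cong (_+_ (f zero)) (sumFin-punchIn (f ∘ suc) j))
                                         (+-x∙yz≈y∙xz (f zero) (f (suc j)) _)

sumFin-offDiagonal-transpose : ∀ {n} (H : Fin (suc n) → Fin (suc n) → ℤ) →
  sumFin (λ j → sumFin (λ k → H j (punchIn j k))) ≡ sumFin (λ j → sumFin (λ k → H (punchIn j k) j))
sumFin-offDiagonal-transpose H = ∙-cancelˡ diagonal _ _ (begin
  diagonal + sumFin (λ j → sumFin (λ k → H j (punchIn j k)))
    ≡⟨ sym (sumFin-+ (λ j → H j j) (λ j → sumFin (λ k → H j (punchIn j k)))) ⟩
  sumFin (λ j → H j j + sumFin (λ k → H j (punchIn j k)))
    ≡⟨ sumFin-cong (λ j → sym (sumFin-punchIn (H j) j)) ⟩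
  sumFin (λ j → sumFin (H j))
    ≡⟨ sumFin-comm H ⟩
  sumFin (λ j → sumFin (λ i → H i j))
    ≡⟨ sumFin-cong (λ j → sumFin-punchIn (λ i → H i j) j) ⟩
  sumFin (λ j → H j j + sumFin (λ k → H (punchIn j k) j))
    ≡⟨ sumFin-+ (λ j → H j j) (λ j → sumFin (λ k → H (punchIn j k) j)) ⟩
  diagonal + sumFin (λ j → sumFin (λ k → H (punchIn j k) j)) ∎)
  where
  diagonal : ℤ
  diagonal = sumFin (λ j → H j j)

sign-+ : ∀ a b → sign (a ℕ.+ b) ≡ sign a * sign b
sign-+ zero    b = sym (ℤP.*-identityˡ (sign b))
sign-+ (suc a) b = trans (cong -_ (sign-+ a b)) (ℤP.neg-distribˡ-* (sign a) (sign b))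

neg-*-neg : ∀ x y → (- x) * (- y) ≡ x * y
neg-*-neg x y = begin
  (- x) * (- y)   ≡⟨ sym (ℤP.neg-distribˡ-* x (- y)) ⟩
  - (x * (- y))   ≡⟨ cong -_ (sym (ℤP.neg-distribʳ-* x y)) ⟩
  - - (x * y)     ≡⟨ ℤP.neg-involutive (x * y) ⟩
  x * y           ∎

sign-sq : ∀ c → sign c * sign c ≡ + 1
sign-sq zero    = refl
sign-sq (suc c) = trans (neg-*-neg (sign c) (sign c)) (sign-sq c)

sign-+-double : ∀ x c → sign (x ℕ.+ (c ℕ.+ c)) ≡ sign x
sign-+-double x c = begin
  sign (x ℕ.+ (c ℕ.+ c))       ≡⟨ sign-+ x (c ℕ.+ c) ⟩
  sign x * sign (c ℕ.+ c)      ≡⟨ cong (sign x *_) (trans (sign-+ c c) (sign-sq c)) ⟩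
  sign x * + 1                 ≡⟨ ℤP.*-identityʳ (sign x) ⟩
  sign x                       ∎

sign-cong-mod-2 : ∀ x y c d → x ℕ.+ (c ℕ.+ c) ≡ y ℕ.+ (d ℕ.+ d) → sign x ≡ sign y
sign-cong-mod-2 x y c d eq =
  trans (sym (sign-+-double x c)) (trans (cong sign eq) (sign-+-double y d))

-- Alternation and a row operation

det-cong : ∀ {n} {A B : Matrix n} → (∀ r c → A r c ≡ B r c) → det A ≡ det B
det-cong {zero}  A≗B = refl
det-cong {suc n} A≗B = sumFin-cong λ j →
  cong₂ (λ a d → sign (toℕ j) * (a * d)) (A≗B zero j) (det-cong (λ r c → A≗B (suc r) (punchIn j c)))

-- A total variant of punchOut; its value at j = i is junk and never used.
punchOut′ : ∀ {n} → Fin (suc (suc n)) → Fin (suc (suc n)) → Fin (suc n)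
punchOut′ zero    zero    = zero
punchOut′ zero    (suc j) = j
punchOut′ (suc i) zero    = zero
punchOut′ {zero}  (suc i) (suc j) = zero
punchOut′ {suc n} (suc i) (suc j) = suc (punchOut′ i j)

punchOut′-punchIn : ∀ {n} (i : Fin (suc (suc n))) j → punchOut′ i (punchIn i j) ≡ j
punchOut′-punchIn zero    j       = refl
punchOut′-punchIn (suc i) zero    = refl
punchOut′-punchIn {suc n} (suc i) (suc j) = cong suc (punchOut′-punchIn i j)

punchIn-punchIn-comm : ∀ {n} (i : Fin (suc (suc n))) j (c : Fin n) →
  punchIn (punchIn i j) (punchIn (punchOut′ (punchIn i j) i) c) ≡ punchIn i (punchIn j c)
punchIn-punchIn-comm zero    j       c       = refl
punchIn-punchIn-comm (suc i) zero    c       = refl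
punchIn-punchIn-comm {suc n} (suc i) (suc j) zero    = refl
punchIn-punchIn-comm {suc n} (suc i) (suc j) (suc c) = cong suc (punchIn-punchIn-comm i j c)

sign-punchIn-punchOut′ : ∀ {n} (i : Fin (suc (suc n))) j →
  sign (toℕ (punchIn i j)) * sign (toℕ (punchOut′ (punchIn i j) i)) ≡ - (sign (toℕ i) * sign (toℕ j))
sign-punchIn-punchOut′ zero j =
  trans (ℤP.*-identityʳ (- sign (toℕ j))) (cong -_ (sym (ℤP.*-identityˡ (sign (toℕ j)))))
sign-punchIn-punchOut′ (suc i) zero = begin
  + 1 * sign (toℕ i)            ≡⟨ ℤP.*-identityˡ (sign (toℕ i)) ⟩
  sign (toℕ i)                  ≡⟨ sym (ℤP.neg-involutive (sign (toℕ i))) ⟩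
  - - sign (toℕ i)              ≡⟨ cong -_ (sym (ℤP.*-identityʳ (- sign (toℕ i)))) ⟩
  - ((- sign (toℕ i)) * + 1)    ∎
sign-punchIn-punchOut′ {suc n} (suc i) (suc j) = begin
  (- sign (toℕ (punchIn i j))) * (- sign (toℕ (punchOut′ (punchIn i j) i)))
    ≡⟨ neg-*-neg (sign (toℕ (punchIn i j))) (sign (toℕ (punchOut′ (punchIn i j) i))) ⟩
  sign (toℕ (punchIn i j)) * sign (toℕ (punchOut′ (punchIn i j) i))
    ≡⟨ sign-punchIn-punchOut′ i j ⟩
  - (sign (toℕ i) * sign (toℕ j))
    ≡⟨ cong -_ (sym (neg-*-neg (sign (toℕ i)) (sign (toℕ j)))) ⟩
  - ((- sign (toℕ i)) * (- sign (toℕ j))) ∎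

-- The term of the Laplace expansion along the first two rows using column i in row 0 and
-- column j ≢ i in row 1.
twoRowTerm : ∀ {n} → Matrix (suc (suc n)) → Fin (suc (suc n)) → Fin (suc (suc n)) → ℤ
twoRowTerm A i j = (sign (toℕ i) * sign (toℕ (punchOut′ i j)))
                 * (A zero i * (A (suc zero) j * det (minor (minor A i) (punchOut′ i j))))

det-twoRowExpansion : ∀ {n} (A : Matrix (suc (suc n))) →
  det A ≡ sumFin (λ i → sumFin (λ j → twoRowTerm A i (punchIn i j)))
det-twoRowExpansion A = sumFin-cong λ i → begin
  sign (toℕ i) * (A zero i * sumFin (λ j → sign (toℕ j) * (b i j * D i j)))
    ≡⟨ cong (sign (toℕ i) *_) (sym (sumFin-*ˡ (A zero i) (λ j → sign (toℕ j) * (b i j * D i j)))) ⟩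
  sign (toℕ i) * sumFin (λ j → A zero i * (sign (toℕ j) * (b i j * D i j)))
    ≡⟨ sym (sumFin-*ˡ (sign (toℕ i)) (λ j → A zero i * (sign (toℕ j) * (b i j * D i j)))) ⟩
  sumFin (λ j → sign (toℕ i) * (A zero i * (sign (toℕ j) * (b i j * D i j))))
    ≡⟨ sumFin-cong (λ j → regroup (sign (toℕ i)) (A zero i) (sign (toℕ j)) (b i j * D i j)) ⟩
  sumFin (λ j → (sign (toℕ i) * sign (toℕ j)) * (A zero i * (b i j * D i j)))
    ≡⟨ sumFin-cong (λ j → cong (λ j′ → (sign (toℕ i) * sign (toℕ j′)) * (A zero i * (b i j * D i j′)))
                               (sym (punchOut′-punchIn i j))) ⟩
  sumFin (λ j → twoRowTerm A i (punchIn i j)) ∎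
  where
  b : ∀ i j → ℤ
  b i j = A (suc zero) (punchIn i j)
  D : ∀ i j → ℤ
  D i j = det (minor (minor A i) j)
  regroup : ∀ s a t x → s * (a * (t * x)) ≡ (s * t) * (a * x)
  regroup s a t x = trans (cong (s *_) (*-x∙yz≈y∙xz a t x)) (sym (ℤP.*-assoc s t (a * x)))

swapFirstRows : ∀ {n} → Matrix (suc (suc n)) → Matrix (suc (suc n))
swapFirstRows A zero          = A (suc zero)
swapFirstRows A (suc zero)    = A zero
swapFirstRows A (suc (suc r)) = A (suc (suc r))

twoRowTerm-swapFirstRows : ∀ {n} (A : Matrix (suc (suc n))) i j →
  twoRowTerm (swapFirstRows A) i (punchIn i j) ≡ - twoRowTerm A (punchIn i j) i
twoRowTerm-swapFirstRows {n} A i j = begin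
  (s * sign (toℕ j′)) * (b * (a * det (minor (minor A i) j′)))
    ≡⟨ cong (λ j′ → (s * sign (toℕ j′)) * (b * (a * det (minor (minor A i) j′)))) (punchOut′-punchIn i j) ⟩
  (s * t) * (b * (a * D))
    ≡⟨ cong ((s * t) *_) (*-x∙yz≈y∙xz b a D) ⟩
  (s * t) * (a * (b * D))
    ≡⟨ cong (_* (a * (b * D))) (sym (ℤP.neg-involutive (s * t))) ⟩
  (- - (s * t)) * (a * (b * D))
    ≡⟨ sym (ℤP.neg-distribˡ-* (- (s * t)) (a * (b * D))) ⟩
  - (- (s * t) * (a * (b * D)))
    ≡⟨ cong₂ (λ u d → - (u * (a * (b * d)))) (sym (sign-punchIn-punchOut′ i j))
             (det-cong (λ r c → cong (A (suc (suc r))) (sym (punchIn-punchIn-comm i j c)))) ⟩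
  - twoRowTerm A (punchIn i j) i ∎
  where
  j′ : Fin (suc n)
  j′ = punchOut′ i (punchIn i j)
  s t a b D : ℤ
  s = sign (toℕ i)
  t = sign (toℕ j)
  a = A zero (punchIn i j)
  b = A (suc zero) i
  D = det (minor (minor A i) j)

det-swapFirstRows : ∀ {n} (A : Matrix (suc (suc n))) → det (swapFirstRows A) ≡ - det A
det-swapFirstRows {n} A = begin
  det (swapFirstRows A)
    ≡⟨ det-twoRowExpansion (swapFirstRows A) ⟩
  sumFin (λ i → sumFin (λ j → twoRowTerm (swapFirstRows A) i (punchIn i j)))
    ≡⟨ sumFin-cong (λ i → sumFin-cong (twoRowTerm-swapFirstRows A i)) ⟩
  sumFin (λ i → sumFin (λ j → - T (punchIn i j) i))
    ≡⟨ sumFin-cong (λ i → sumFin-neg (λ j → T (punchIn i j) i)) ⟩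
  sumFin (λ i → - sumFin (λ j → T (punchIn i j) i))
    ≡⟨ sumFin-neg (λ i → sumFin (λ j → T (punchIn i j) i)) ⟩
  - sumFin (λ i → sumFin (λ j → T (punchIn i j) i))
    ≡⟨ cong -_ (sym (sumFin-offDiagonal-transpose T)) ⟩
  - sumFin (λ i → sumFin (λ j → T i (punchIn i j)))
    ≡⟨ cong -_ (sym (det-twoRowExpansion A)) ⟩
  - det A ∎
  where
  T : Fin (suc (suc n)) → Fin (suc (suc n)) → ℤ
  T = twoRowTerm A

det-equalFirstRows : ∀ {n} (A : Matrix (suc (suc n))) →
  (∀ c → A zero c ≡ A (suc zero) c) → det A ≡ + 0
det-equalFirstRows A A₀≗A₁ = x≡-x⇒x≡0 (det A) (begin
  det A                  ≡⟨ det-cong swap≗id ⟨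
  det (swapFirstRows A)  ≡⟨ det-swapFirstRows A ⟩
  - det A                ∎)
  where
  x≡-x⇒x≡0 : ∀ x → x ≡ - x → x ≡ + 0
  x≡-x⇒x≡0 (+ zero)   _ = refl
  x≡-x⇒x≡0 -[1+ _ ]   ()
  swap≗id : ∀ r c → swapFirstRows A r c ≡ A r c
  swap≗id zero          c = sym (A₀≗A₁ c)
  swap≗id (suc zero)    c = A₀≗A₁ c
  swap≗id (suc (suc r)) c = refl

withFirstRow : ∀ {n} → (Fin (suc n) → ℤ) → Matrix (suc n) → Matrix (suc n)
withFirstRow u A zero    = u
withFirstRow u A (suc r) = A (suc r)

det-withFirstRow-difference : ∀ {n} (u v : Fin (suc n) → ℤ) (A : Matrix (suc n)) →
  det (withFirstRow (λ c → u c - v c) A) ≡ det (withFirstRow u A) - det (withFirstRow v A)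
det-withFirstRow-difference {n} u v A = begin
  sumFin (λ j → s j * ((u j - v j) * d j))
    ≡⟨ sumFin-cong (λ j → distrib (s j) (u j) (v j) (d j)) ⟩
  sumFin (λ j → s j * (u j * d j) + - (s j * (v j * d j)))
    ≡⟨ sumFin-+ (λ j → s j * (u j * d j)) (λ j → - (s j * (v j * d j))) ⟩
  sumFin (λ j → s j * (u j * d j)) + sumFin (λ j → - (s j * (v j * d j)))
    ≡⟨ cong (_+_ (sumFin (λ j → s j * (u j * d j)))) (sumFin-neg (λ j → s j * (v j * d j))) ⟩
  sumFin (λ j → s j * (u j * d j)) - sumFin (λ j → s j * (v j * d j)) ∎
  where
  s d : Fin (suc n) → ℤ
  s j = sign (toℕ j)
  d j = det (minor A j)
  distrib : ∀ s x y d → s * ((x - y) * d) ≡ s * (x * d) + - (s * (y * d))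
  distrib s x y d = begin
    s * ((x - y) * d)              ≡⟨ cong (s *_) (ℤP.*-distribʳ-+ d x (- y)) ⟩
    s * (x * d + (- y) * d)        ≡⟨ ℤP.*-distribˡ-+ s (x * d) ((- y) * d) ⟩
    s * (x * d) + s * ((- y) * d)  ≡⟨ cong (λ z → s * (x * d) + s * z) (sym (ℤP.neg-distribˡ-* y d)) ⟩
    s * (x * d) + s * - (y * d)    ≡⟨ cong (_+_ (s * (x * d))) (sym (ℤP.neg-distribʳ-* s (y * d))) ⟩
    s * (x * d) + - (s * (y * d))  ∎

pairDiff : ∀ {n} → (Fin n → ℤ) → Fin n → ℤ
pairDiff {suc (suc n)} v zero          = v zero - v (suc zero)
pairDiff {suc (suc n)} v (suc zero)    = v (suc zero)
pairDiff {suc (suc n)} v (suc (suc i)) = pairDiff (λ i → v (suc (suc i))) i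
pairDiff {suc zero}    v i             = v i

pairDiffRows : ∀ {n} → Matrix n → Matrix n
pairDiffRows A r c = pairDiff (λ r′ → A r′ c) r

det-pairDiffRows : ∀ {n} (A : Matrix n) → det (pairDiffRows A) ≡ det A
det-pairDiffRows {zero}        A = refl
det-pairDiffRows {suc zero}    A = refl
det-pairDiffRows {suc (suc n)} A = begin
  det (pairDiffRows A)
    ≡⟨ det-withFirstRow-difference (A zero) (A (suc zero)) (pairDiffRows A) ⟩
  det (withFirstRow (A zero) (pairDiffRows A)) - det (withFirstRow (A (suc zero)) (pairDiffRows A))
    ≡⟨ cong₂ _-_ sameFirstTwoRows
                 (det-equalFirstRows (withFirstRow (A (suc zero)) (pairDiffRows A)) (λ _ → refl)) ⟩
  det A - + 0
    ≡⟨ ℤP.+-identityʳ (det A) ⟩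
  det A ∎
  where
  -- The (n − 2)-minors of pairDiffRows A along the first two rows are pairDiffRows of those of A.
  sameFirstTwoRows : det (withFirstRow (A zero) (pairDiffRows A)) ≡ det A
  sameFirstTwoRows = sumFin-cong λ i → cong (λ d → sign (toℕ i) * (A zero i * d)) (sumFin-cong λ j →
    cong (λ d → sign (toℕ j) * (A (suc zero) (punchIn i j) * d)) (det-pairDiffRows (minor (minor A i) j)))

-- Laplace expansion along an interleaving of the rows

-- An interleaving of k left and l right positions making up Fin n; lefts and rights list them
-- in increasing order.
data Shuffle : ℕ → ℕ → ℕ → Set where
  []    : Shuffle 0 0 0
  left  : ∀ {n k l} → Shuffle n k l → Shuffle (suc n) (suc k) l
  right : ∀ {n k l} → Shuffle n k l → Shuffle (suc n) k (suc l)

lefts : ∀ {n k l} → Shuffle n k l → Fin k → Fin n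
lefts (left s)  zero    = zero
lefts (left s)  (suc i) = suc (lefts s i)
lefts (right s) i       = suc (lefts s i)

rights : ∀ {n k l} → Shuffle n k l → Fin l → Fin n
rights (left s)  j       = suc (rights s j)
rights (right s) zero    = zero
rights (right s) (suc j) = suc (rights s j)

-- The number of pairs of a right position before a left one: (-1) ^ inversions is the sign of
-- the permutation that moves all left positions to the front.
inversions : ∀ {n k l} → Shuffle n k l → ℕ
inversions []                = 0
inversions (left s)          = inversions s
inversions (right {k = k} s) = inversions s ℕ.+ k

deleteLeft : ∀ {n k l} → Shuffle (suc n) (suc k) l → Fin (suc k) → Shuffle n k l
deleteLeft (left s) zero = s
deleteLeft {suc n} {suc k} (left s) (suc i) = left (deleteLeft s i)
deleteLeft {suc n} (right s) i = right (deleteLeft s i)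

deleteRight : ∀ {n k l} → Shuffle (suc n) k (suc l) → Fin (suc l) → Shuffle n k l
deleteRight (right s) zero = s
deleteRight {suc n} {l = suc l} (right s) (suc j) = right (deleteRight s j)
deleteRight {suc n} (left s) j = left (deleteRight s j)

punchIn-lefts-deleteLeft : ∀ {n k l} (s : Shuffle (suc n) (suc k) l) i j →
  punchIn (lefts s i) (lefts (deleteLeft s i) j) ≡ lefts s (punchIn i j)
punchIn-lefts-deleteLeft (left s) zero j = refl
punchIn-lefts-deleteLeft {suc n} {suc k} (left s) (suc i) zero = refl
punchIn-lefts-deleteLeft {suc n} {suc k} (left s) (suc i) (suc j) =
  cong suc (punchIn-lefts-deleteLeft s i j)
punchIn-lefts-deleteLeft {suc n} (right s) i j = cong suc (punchIn-lefts-deleteLeft s i j)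

punchIn-rights-deleteLeft : ∀ {n k l} (s : Shuffle (suc n) (suc k) l) i j →
  punchIn (lefts s i) (rights (deleteLeft s i) j) ≡ rights s j
punchIn-rights-deleteLeft (left s) zero j = refl
punchIn-rights-deleteLeft {suc n} {suc k} (left s) (suc i) j =
  cong suc (punchIn-rights-deleteLeft s i j)
punchIn-rights-deleteLeft {suc n} (right s) i zero = refl
punchIn-rights-deleteLeft {suc n} (right s) i (suc j) = cong suc (punchIn-rights-deleteLeft s i j)

punchIn-lefts-deleteRight : ∀ {n k l} (s : Shuffle (suc n) k (suc l)) i j →
  punchIn (rights s i) (lefts (deleteRight s i) j) ≡ lefts s j
punchIn-lefts-deleteRight (right s) zero j = refl
punchIn-lefts-deleteRight {suc n} {l = suc l} (right s) (suc i) j =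
  cong suc (punchIn-lefts-deleteRight s i j)
punchIn-lefts-deleteRight {suc n} (left s) i zero = refl
punchIn-lefts-deleteRight {suc n} (left s) i (suc j) = cong suc (punchIn-lefts-deleteRight s i j)

punchIn-rights-deleteRight : ∀ {n k l} (s : Shuffle (suc n) k (suc l)) i j →
  punchIn (rights s i) (rights (deleteRight s i) j) ≡ rights s (punchIn i j)
punchIn-rights-deleteRight (right s) zero j = refl
punchIn-rights-deleteRight {suc n} {l = suc l} (right s) (suc i) zero = refl
punchIn-rights-deleteRight {suc n} {l = suc l} (right s) (suc i) (suc j) =
  cong suc (punchIn-rights-deleteRight s i j)
punchIn-rights-deleteRight {suc n} (left s) i j = cong suc (punchIn-rights-deleteRight s i j)

lefts-deleteLeft-inversions : ∀ {n k l} (s : Shuffle (suc n) (suc k) l) i →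
  toℕ (lefts s i) ℕ.+ inversions (deleteLeft s i) ≡ toℕ i ℕ.+ inversions s
lefts-deleteLeft-inversions (left s) zero = refl
lefts-deleteLeft-inversions {suc n} {suc k} (left s) (suc i) =
  cong suc (lefts-deleteLeft-inversions s i)
lefts-deleteLeft-inversions {suc n} {k} (right s) i = begin
  suc (toℕ (lefts s i)) ℕ.+ (inversions (deleteLeft s i) ℕ.+ k)
    ≡⟨ cong suc (sym (ℕP.+-assoc (toℕ (lefts s i)) _ k)) ⟩
  suc (toℕ (lefts s i) ℕ.+ inversions (deleteLeft s i) ℕ.+ k)
    ≡⟨ cong (λ x → suc (x ℕ.+ k)) (lefts-deleteLeft-inversions s i) ⟩
  suc (toℕ i ℕ.+ inversions s ℕ.+ k)
    ≡⟨ cong suc (ℕP.+-assoc (toℕ i) (inversions s) k) ⟩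
  suc (toℕ i ℕ.+ (inversions s ℕ.+ k))
    ≡⟨ sym (ℕP.+-suc (toℕ i) (inversions s ℕ.+ k)) ⟩
  toℕ i ℕ.+ suc (inversions s ℕ.+ k)
    ≡⟨ cong (toℕ i ℕ.+_) (sym (ℕP.+-suc (inversions s) k)) ⟩
  toℕ i ℕ.+ (inversions s ℕ.+ suc k) ∎

rights-deleteRight-inversions : ∀ {n k l} (s : Shuffle (suc n) k (suc l)) i →
  toℕ (rights s i) ℕ.+ inversions s ≡ toℕ i ℕ.+ inversions (deleteRight s i) ℕ.+ k
rights-deleteRight-inversions (right s) zero = refl
rights-deleteRight-inversions {suc n} {k} {suc l} (right s) (suc i) = begin
  suc (toℕ (rights s i) ℕ.+ (inversions s ℕ.+ k))
    ≡⟨ cong suc (sym (ℕP.+-assoc (toℕ (rights s i)) (inversions s) k)) ⟩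
  suc (toℕ (rights s i) ℕ.+ inversions s ℕ.+ k)
    ≡⟨ cong (λ x → suc (x ℕ.+ k)) (rights-deleteRight-inversions s i) ⟩
  suc (toℕ i ℕ.+ inversions (deleteRight s i) ℕ.+ k ℕ.+ k)
    ≡⟨ cong (λ x → suc (x ℕ.+ k)) (ℕP.+-assoc (toℕ i) (inversions (deleteRight s i)) k) ⟩
  suc (toℕ i ℕ.+ (inversions (deleteRight s i) ℕ.+ k) ℕ.+ k) ∎
rights-deleteRight-inversions {suc n} {suc k} (left s) i = begin
  suc (toℕ (rights s i) ℕ.+ inversions s)
    ≡⟨ cong suc (rights-deleteRight-inversions s i) ⟩
  suc (toℕ i ℕ.+ inversions (deleteRight s i) ℕ.+ k)
    ≡⟨ sym (ℕP.+-suc (toℕ i ℕ.+ inversions (deleteRight s i)) k) ⟩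
  toℕ i ℕ.+ inversions (deleteRight s i) ℕ.+ suc k ∎

sumFin-shuffle : ∀ {n k l} (s : Shuffle n k l) (f : Fin n → ℤ) →
  sumFin f ≡ sumFin (f ∘ lefts s) + sumFin (f ∘ rights s)
sumFin-shuffle []        f = refl
sumFin-shuffle (left s)  f = trans (cong (_+_ (f zero)) (sumFin-shuffle s (f ∘ suc)))
                                   (sym (ℤP.+-assoc (f zero) (sumFin (f ∘ suc ∘ lefts s)) _))
sumFin-shuffle (right s) f = trans (cong (_+_ (f zero)) (sumFin-shuffle s (f ∘ suc)))
                                   (+-x∙yz≈y∙xz (f zero) (sumFin (f ∘ suc ∘ lefts s)) _)

laplaceSign-deleteLeft : ∀ {n k l} r (s : Shuffle (suc n) (suc k) l) i →
  sign (toℕ (lefts s i)) * sign (r ℕ.+ inversions (deleteLeft s i))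
    ≡ sign (r ℕ.+ inversions s) * sign (toℕ i)
laplaceSign-deleteLeft r s i = begin
  sign L * sign (r ℕ.+ d)      ≡⟨ sym (sign-+ L (r ℕ.+ d)) ⟩
  sign (L ℕ.+ (r ℕ.+ d))       ≡⟨ cong sign exponents ⟩
  sign (r ℕ.+ c ℕ.+ toℕ i)     ≡⟨ sign-+ (r ℕ.+ c) (toℕ i) ⟩
  sign (r ℕ.+ c) * sign (toℕ i) ∎
  where
  L d c : ℕ
  L = toℕ (lefts s i)
  d = inversions (deleteLeft s i)
  c = inversions s
  exponents : L ℕ.+ (r ℕ.+ d) ≡ r ℕ.+ c ℕ.+ toℕ i
  exponents = begin
    L ℕ.+ (r ℕ.+ d)    ≡⟨ ℕ+-x∙yz≈y∙xz L r d ⟩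
    r ℕ.+ (L ℕ.+ d)    ≡⟨ cong (r ℕ.+_) (lefts-deleteLeft-inversions s i) ⟩
    r ℕ.+ (toℕ i ℕ.+ c) ≡⟨ cong (r ℕ.+_) (ℕP.+-comm (toℕ i) c) ⟩
    r ℕ.+ (c ℕ.+ toℕ i) ≡⟨ sym (ℕP.+-assoc r c (toℕ i)) ⟩
    r ℕ.+ c ℕ.+ toℕ i   ∎

laplaceSign-deleteRight : ∀ {n k l} r (s : Shuffle (suc n) k (suc l)) i →
  sign (toℕ (rights s i)) * sign (r ℕ.+ inversions (deleteRight s i))
    ≡ sign (r ℕ.+ k ℕ.+ inversions s) * sign (toℕ i)
laplaceSign-deleteRight {k = k} r s i = begin
  sign R * sign (r ℕ.+ d)
    ≡⟨ sym (sign-+ R (r ℕ.+ d)) ⟩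
  sign (R ℕ.+ (r ℕ.+ d))
    ≡⟨ sign-cong-mod-2 (R ℕ.+ (r ℕ.+ d)) (r ℕ.+ k ℕ.+ c ℕ.+ toℕ i) c d exponents ⟩
  sign (r ℕ.+ k ℕ.+ c ℕ.+ toℕ i)
    ≡⟨ sign-+ (r ℕ.+ k ℕ.+ c) (toℕ i) ⟩
  sign (r ℕ.+ k ℕ.+ c) * sign (toℕ i) ∎
  where
  R d c : ℕ
  R = toℕ (rights s i)
  d = inversions (deleteRight s i)
  c = inversions s
  exponents : R ℕ.+ (r ℕ.+ d) ℕ.+ (c ℕ.+ c) ≡ r ℕ.+ k ℕ.+ c ℕ.+ toℕ i ℕ.+ (d ℕ.+ d)
  exponents = begin
    R ℕ.+ (r ℕ.+ d) ℕ.+ (c ℕ.+ c)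
      ≡⟨ regroup₁ R r d c ⟩
    R ℕ.+ c ℕ.+ (r ℕ.+ d ℕ.+ c)
      ≡⟨ cong (ℕ._+ (r ℕ.+ d ℕ.+ c)) (rights-deleteRight-inversions s i) ⟩
    toℕ i ℕ.+ d ℕ.+ k ℕ.+ (r ℕ.+ d ℕ.+ c)
      ≡⟨ regroup₂ (toℕ i) d k r c ⟩
    r ℕ.+ k ℕ.+ c ℕ.+ toℕ i ℕ.+ (d ℕ.+ d) ∎
    where
    regroup₁ : ∀ R r d c → R ℕ.+ (r ℕ.+ d) ℕ.+ (c ℕ.+ c) ≡ R ℕ.+ c ℕ.+ (r ℕ.+ d ℕ.+ c)
    regroup₁ = ℕSolver.solve-∀
    regroup₂ : ∀ i d k r c → i ℕ.+ d ℕ.+ k ℕ.+ (r ℕ.+ d ℕ.+ c) ≡ r ℕ.+ k ℕ.+ c ℕ.+ i ℕ.+ (d ℕ.+ d)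
    regroup₂ = ℕSolver.solve-∀

submatrix : ∀ {n k} → Matrix n → (Fin k → Fin n) → (Fin k → Fin n) → Matrix k
submatrix A ρ κ i j = A (ρ i) (κ j)

ZeroBlock : ∀ {n k l k′ l′} → Shuffle n k l → Shuffle n k′ l′ → Matrix n → Set
ZeroBlock rs cs A = ∀ i j → A (lefts rs i) (rights cs j) ≡ + 0

laplaceTerm : ∀ {n} → Matrix (suc n) → Fin (suc n) → ℤ
laplaceTerm A j = sign (toℕ j) * (A zero j * det (minor A j))

laplaceTerm-zeroEntry : ∀ {n} (A : Matrix (suc n)) j → A zero j ≡ + 0 → laplaceTerm A j ≡ + 0
laplaceTerm-zeroEntry A j a≡0 =
  trans (cong (λ a → sign (toℕ j) * (a * det (minor A j))) a≡0) (ℤP.*-zeroʳ (sign (toℕ j)))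

laplaceTerm-zeroMinor : ∀ {n} (A : Matrix (suc n)) j → det (minor A j) ≡ + 0 → laplaceTerm A j ≡ + 0
laplaceTerm-zeroMinor A j d≡0 = begin
  sign (toℕ j) * (A zero j * det (minor A j)) ≡⟨ cong (λ d → sign (toℕ j) * (A zero j * d)) d≡0 ⟩
  sign (toℕ j) * (A zero j * + 0)             ≡⟨ cong (sign (toℕ j) *_) (ℤP.*-zeroʳ (A zero j)) ⟩
  sign (toℕ j) * + 0                          ≡⟨ ℤP.*-zeroʳ (sign (toℕ j)) ⟩
  + 0                                         ∎

zeroBlock-minor-deleteLeft : ∀ {n k l k′ l′} (rs : Shuffle n k l) (cs : Shuffle (suc n) (suc k′) l′)
  (A : Matrix (suc n)) → (∀ a b → A (suc (lefts rs a)) (rights cs b) ≡ + 0) →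
  ∀ i → ZeroBlock rs (deleteLeft cs i) (minor A (lefts cs i))
zeroBlock-minor-deleteLeft rs cs A z i a b =
  trans (cong (A (suc (lefts rs a))) (punchIn-rights-deleteLeft cs i b)) (z a b)

zeroBlock-minor-deleteRight : ∀ {n k l k′ l′} (rs : Shuffle n k l) (cs : Shuffle (suc n) k′ (suc l′))
  (A : Matrix (suc n)) → (∀ a b → A (suc (lefts rs a)) (rights cs b) ≡ + 0) →
  ∀ i → ZeroBlock rs (deleteRight cs i) (minor A (rights cs i))
zeroBlock-minor-deleteRight rs cs A z i a b =
  trans (cong (A (suc (lefts rs a))) (punchIn-rights-deleteRight cs i b)) (z a (punchIn i b))

-- The k left rows are supported on the k′ < k left columns.
mutual
  det-zeroBlock-unbalanced : ∀ {n k l k′ l′} (rs : Shuffle n k l) (cs : Shuffle n k′ l′)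
    (A : Matrix n) → k′ ℕ.< k → ZeroBlock rs cs A → det A ≡ + 0
  det-zeroBlock-unbalanced [] cs A ()
  det-zeroBlock-unbalanced (left rs) cs A (s≤s k′≤k) z =
    trans (sumFin-shuffle cs (laplaceTerm A)) (cong₂ _+_
      (sumFin-zero λ i → laplaceTerm-zeroMinor A (lefts cs i)
                           (det-minor-lefts-zero rs cs A k′≤k (z ∘ suc) i))
      (sumFin-zero λ j → laplaceTerm-zeroEntry A (rights cs j) (z zero j)))
  det-zeroBlock-unbalanced (right rs) cs A k′<k z =
    trans (sumFin-shuffle cs (laplaceTerm A)) (cong₂ _+_
      (sumFin-zero λ i → laplaceTerm-zeroMinor A (lefts cs i)
                           (det-minor-lefts-zero rs cs A (ℕP.<⇒≤ k′<k) z i))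
      (sumFin-zero λ j → laplaceTerm-zeroMinor A (rights cs j)
                           (det-minor-rights-zero rs cs A k′<k z j)))

  det-minor-lefts-zero : ∀ {n k l k′ l′} (rs : Shuffle n k l) (cs : Shuffle (suc n) k′ l′)
    (A : Matrix (suc n)) → k′ ℕ.≤ k → (∀ a b → A (suc (lefts rs a)) (rights cs b) ≡ + 0) →
    ∀ i → det (minor A (lefts cs i)) ≡ + 0
  det-minor-lefts-zero {k′ = suc _} rs cs A k′≤k z i =
    det-zeroBlock-unbalanced rs (deleteLeft cs i) (minor A (lefts cs i)) k′≤k
      (zeroBlock-minor-deleteLeft rs cs A z i)

  det-minor-rights-zero : ∀ {n k l k′ l′} (rs : Shuffle n k l) (cs : Shuffle (suc n) k′ l′)
    (A : Matrix (suc n)) → k′ ℕ.< k → (∀ a b → A (suc (lefts rs a)) (rights cs b) ≡ + 0) →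
    ∀ j → det (minor A (rights cs j)) ≡ + 0
  det-minor-rights-zero {l′ = suc _} rs cs A k′<k z j =
    det-zeroBlock-unbalanced rs (deleteRight cs j) (minor A (rights cs j)) k′<k
      (zeroBlock-minor-deleteRight rs cs A z j)

*-rearrange : ∀ s a t x y u v → s * t ≡ u * v → s * (a * (t * (x * y))) ≡ u * (y * (v * (a * x)))
*-rearrange s a t x y u v st≡uv = begin
  s * (a * (t * (x * y)))   ≡⟨ pullSigns s a t x y ⟩
  (s * t) * (y * (a * x))   ≡⟨ cong (_* (y * (a * x))) st≡uv ⟩
  (u * v) * (y * (a * x))   ≡⟨ pushSign u v y a x ⟩
  u * (y * (v * (a * x)))   ∎
  where
  pullSigns : ∀ s a t x y → s * (a * (t * (x * y))) ≡ (s * t) * (y * (a * x))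
  pullSigns = ℤSolver.solve-∀
  pushSign : ∀ u v y a x → (u * v) * (y * (a * x)) ≡ u * (y * (v * (a * x)))
  pushSign = ℤSolver.solve-∀

mutual
  det-zeroBlock : ∀ {n k l} (rs cs : Shuffle n k l) (A : Matrix n) → ZeroBlock rs cs A →
    det A ≡ sign (inversions rs ℕ.+ inversions cs)
            * (det (submatrix A (lefts rs) (lefts cs)) * det (submatrix A (rights rs) (rights cs)))
  det-zeroBlock [] [] A z = refl
  det-zeroBlock {suc n} {suc k} {l} (left rs) cs A z = begin
    det A
      ≡⟨ sumFin-shuffle cs (laplaceTerm A) ⟩
    sumFin (laplaceTerm A ∘ lefts cs) + sumFin (laplaceTerm A ∘ rights cs)
      ≡⟨ cong₂ _+_ (sumFin-cong (laplaceTerm-lefts-zeroBlock rs cs A z))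
                   (sumFin-zero λ j → laplaceTerm-zeroEntry A (rights cs j) (z zero j)) ⟩
    sumFin (λ i → ε * (det Y * laplaceTerm X i)) + + 0
      ≡⟨ ℤP.+-identityʳ _ ⟩
    sumFin (λ i → ε * (det Y * laplaceTerm X i))
      ≡⟨ sumFin-*ˡ ε (λ i → det Y * laplaceTerm X i) ⟩
    ε * sumFin (λ i → det Y * laplaceTerm X i)
      ≡⟨ cong (ε *_) (trans (sumFin-*ˡ (det Y) (laplaceTerm X)) (ℤP.*-comm (det Y) (det X))) ⟩
    ε * (det X * det Y) ∎
    where
    ε : ℤ
    ε = sign (inversions rs ℕ.+ inversions cs)
    X : Matrix (suc k)
    X = submatrix A (lefts (left rs)) (lefts cs)
    Y : Matrix l
    Y = submatrix A (rights (left rs)) (rights cs)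
  det-zeroBlock {suc n} {k} {suc l} (right rs) cs A z = begin
    det A
      ≡⟨ sumFin-shuffle cs (laplaceTerm A) ⟩
    sumFin (laplaceTerm A ∘ lefts cs) + sumFin (laplaceTerm A ∘ rights cs)
      ≡⟨ cong₂ _+_ (sumFin-zero λ i → laplaceTerm-zeroMinor A (lefts cs i)
                                        (det-minor-lefts-zero rs cs A ℕP.≤-refl z i))
                   (sumFin-cong (laplaceTerm-rights-zeroBlock rs cs A z)) ⟩
    + 0 + sumFin (λ j → ε * (det X * laplaceTerm Y j))
      ≡⟨ ℤP.+-identityˡ _ ⟩
    sumFin (λ j → ε * (det X * laplaceTerm Y j))
      ≡⟨ sumFin-*ˡ ε (λ j → det X * laplaceTerm Y j) ⟩
    ε * sumFin (λ j → det X * laplaceTerm Y j)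
      ≡⟨ cong (ε *_) (sumFin-*ˡ (det X) (laplaceTerm Y)) ⟩
    ε * (det X * det Y) ∎
    where
    ε : ℤ
    ε = sign (inversions rs ℕ.+ k ℕ.+ inversions cs)
    X : Matrix k
    X = submatrix A (lefts (right rs)) (lefts cs)
    Y : Matrix (suc l)
    Y = submatrix A (rights (right rs)) (rights cs)

  laplaceTerm-lefts-zeroBlock : ∀ {n k l} (rs : Shuffle n k l) (cs : Shuffle (suc n) (suc k) l)
    (A : Matrix (suc n)) → ZeroBlock (left rs) cs A → ∀ i →
    laplaceTerm A (lefts cs i)
      ≡ sign (inversions rs ℕ.+ inversions cs)
        * (det (submatrix A (rights (left rs)) (rights cs))
           * laplaceTerm (submatrix A (lefts (left rs)) (lefts cs)) i)
  laplaceTerm-lefts-zeroBlock {n} {k} {l} rs cs A z i = begin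
    sign L * (a * det M)
      ≡⟨ cong (λ d → sign L * (a * d))
              (det-zeroBlock rs (deleteLeft cs i) M (zeroBlock-minor-deleteLeft rs cs A (z ∘ suc) i)) ⟩
    sign L * (a * (sign (r ℕ.+ d) * (det (submatrix M (lefts rs) (lefts (deleteLeft cs i)))
                                     * det (submatrix M (rights rs) (rights (deleteLeft cs i))))))
      ≡⟨ cong₂ (λ x y → sign L * (a * (sign (r ℕ.+ d) * (x * y))))
               (det-cong λ p q → cong (A (suc (lefts rs p))) (punchIn-lefts-deleteLeft cs i q))
               (det-cong λ p q → cong (A (suc (rights rs p))) (punchIn-rights-deleteLeft cs i q)) ⟩
    sign L * (a * (sign (r ℕ.+ d) * (det (minor X i) * det Y)))
      ≡⟨ *-rearrange (sign L) a (sign (r ℕ.+ d)) (det (minor X i)) (det Y)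
                     (sign (r ℕ.+ inversions cs)) (sign (toℕ i)) (laplaceSign-deleteLeft r cs i) ⟩
    sign (r ℕ.+ inversions cs) * (det Y * laplaceTerm X i) ∎
    where
    L r d : ℕ
    L = toℕ (lefts cs i)
    r = inversions rs
    d = inversions (deleteLeft cs i)
    a : ℤ
    a = A zero (lefts cs i)
    M : Matrix n
    M = minor A (lefts cs i)
    X : Matrix (suc k)
    X = submatrix A (lefts (left rs)) (lefts cs)
    Y : Matrix l
    Y = submatrix A (rights (left rs)) (rights cs)

  laplaceTerm-rights-zeroBlock : ∀ {n k l} (rs : Shuffle n k l) (cs : Shuffle (suc n) k (suc l))
    (A : Matrix (suc n)) → ZeroBlock (right rs) cs A → ∀ j →
    laplaceTerm A (rights cs j)
      ≡ sign (inversions rs ℕ.+ k ℕ.+ inversions cs)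
        * (det (submatrix A (lefts (right rs)) (lefts cs))
           * laplaceTerm (submatrix A (rights (right rs)) (rights cs)) j)
  laplaceTerm-rights-zeroBlock {n} {k} {l} rs cs A z j = begin
    sign R * (a * det M)
      ≡⟨ cong (λ d → sign R * (a * d))
              (det-zeroBlock rs (deleteRight cs j) M (zeroBlock-minor-deleteRight rs cs A z j)) ⟩
    sign R * (a * (sign (r ℕ.+ d) * (det (submatrix M (lefts rs) (lefts (deleteRight cs j)))
                                     * det (submatrix M (rights rs) (rights (deleteRight cs j))))))
      ≡⟨ cong₂ (λ x y → sign R * (a * (sign (r ℕ.+ d) * (x * y))))
               (det-cong λ p q → cong (A (suc (lefts rs p))) (punchIn-lefts-deleteRight cs j q))
               (det-cong λ p q → cong (A (suc (rights rs p))) (punchIn-rights-deleteRight cs j q)) ⟩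
    sign R * (a * (sign (r ℕ.+ d) * (det X * det (minor Y j))))
      ≡⟨ cong (λ x → sign R * (a * (sign (r ℕ.+ d) * x))) (ℤP.*-comm (det X) (det (minor Y j))) ⟩
    sign R * (a * (sign (r ℕ.+ d) * (det (minor Y j) * det X)))
      ≡⟨ *-rearrange (sign R) a (sign (r ℕ.+ d)) (det (minor Y j)) (det X)
                     (sign (r ℕ.+ k ℕ.+ inversions cs)) (sign (toℕ j)) (laplaceSign-deleteRight r cs j) ⟩
    sign (r ℕ.+ k ℕ.+ inversions cs) * (det X * laplaceTerm Y j) ∎
    where
    R r d : ℕ
    R = toℕ (rights cs j)
    r = inversions rs
    d = inversions (deleteRight cs j)
    a : ℤ
    a = A zero (rights cs j)
    M : Matrix n
    M = minor A (rights cs j)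
    X : Matrix k
    X = submatrix A (lefts (right rs)) (lefts cs)
    Y : Matrix (suc l)
    Y = submatrix A (rights (right rs)) (rights cs)

Unimodular : ∀ {n} → Matrix n → Set
Unimodular A = ∣ det A ∣ ≡ 1

∣sign∣≡1 : ∀ e → ∣ sign e ∣ ≡ 1
∣sign∣≡1 zero    = refl
∣sign∣≡1 (suc e) = trans (ℤP.∣-i∣≡∣i∣ (sign e)) (∣sign∣≡1 e)

unimodular-pairDiffRows : ∀ {n} (A : Matrix n) → Unimodular (pairDiffRows A) → Unimodular A
unimodular-pairDiffRows A = trans (cong ∣_∣ (sym (det-pairDiffRows A)))

unimodular-zeroBlock : ∀ {n k l} (rs cs : Shuffle n k l) (A : Matrix n) {X : Matrix k} {Y : Matrix l} →
  ZeroBlock rs cs A →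
  (∀ i j → A (lefts rs i) (lefts cs j) ≡ X i j) → (∀ i j → A (rights rs i) (rights cs j) ≡ Y i j) →
  Unimodular X → Unimodular Y → Unimodular A
unimodular-zeroBlock rs cs A {X} {Y} zeroBlock X≗ Y≗ X-unimodular Y-unimodular = begin
  ∣ det A ∣
    ≡⟨ cong ∣_∣ (trans (det-zeroBlock rs cs A zeroBlock)
                       (cong₂ (λ x y → ε * (x * y)) (det-cong X≗) (det-cong Y≗))) ⟩
  ∣ ε * (det X * det Y) ∣
    ≡⟨ trans (ℤP.abs-* ε (det X * det Y)) (cong (∣ ε ∣ ℕ.*_) (ℤP.abs-* (det X) (det Y))) ⟩
  ∣ ε ∣ ℕ.* (∣ det X ∣ ℕ.* ∣ det Y ∣)
    ≡⟨ cong₂ (λ e d → e ℕ.* d) (∣sign∣≡1 (inversions rs ℕ.+ inversions cs))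
                               (cong₂ ℕ._*_ X-unimodular Y-unimodular) ⟩
  1 ∎
  where
  ε : ℤ
  ε = sign (inversions rs ℕ.+ inversions cs)

-- Pascal's triangle modulo 2

double : ℕ → ℕ
double zero    = zero
double (suc n) = suc (suc (double n))

data Halving : ℕ → Set where
  even : ∀ x → Halving (double x)
  odd  : ∀ x → Halving (suc (double x))

halving : ∀ n → Halving n
halving zero = even zero
halving (suc n) with halving n
... | even x = odd x
... | odd x  = even (suc x)

⌊double/2⌋ : ∀ x → ⌊ double x /2⌋ ≡ x
⌊double/2⌋ zero    = refl
⌊double/2⌋ (suc x) = cong suc (⌊double/2⌋ x)

⌊suc-double/2⌋ : ∀ x → ⌊ suc (double x) /2⌋ ≡ x
⌊suc-double/2⌋ zero    = refl
⌊suc-double/2⌋ (suc x) = cong suc (⌊suc-double/2⌋ x)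

double-+-double : ∀ a b → double a ℕ.+ double b ≡ double (a ℕ.+ b)
double-+-double zero    b = refl
double-+-double (suc a) b = cong (λ n → suc (suc n)) (double-+-double a b)

double-+-suc-double : ∀ a b → double a ℕ.+ suc (double b) ≡ suc (double (a ℕ.+ b))
double-+-suc-double a b = trans (ℕP.+-suc (double a) (double b)) (cong suc (double-+-double a b))

suc-double-+-double : ∀ a b → suc (double a) ℕ.+ double b ≡ suc (double (a ℕ.+ b))
suc-double-+-double a b = cong suc (double-+-double a b)

suc-double-+-suc-double : ∀ a b → suc (double a) ℕ.+ suc (double b) ≡ double (suc (a ℕ.+ b))
suc-double-+-suc-double a b = cong suc (double-+-suc-double a b)

pascal₂ : ℕ → ℕ → Bool
pascal₂ zero    j       = true
pascal₂ (suc i) zero    = true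
pascal₂ (suc i) (suc j) = pascal₂ i (suc j) xor pascal₂ (suc i) j

bit : Bool → ℕ
bit true  = 1
bit false = 0

bit-xor : ∀ a b → bit (a xor b) ≡ (bit a ℕ.+ bit b) % 2
bit-xor true  true  = refl
bit-xor true  false = refl
bit-xor false true  = refl
bit-xor false false = refl

binomial-mod-2 : ∀ i j → ((i ℕ.+ j) C i) % 2 ≡ bit (pascal₂ i j)
binomial-mod-2 zero    j = refl
binomial-mod-2 (suc i) zero rewrite ℕP.+-identityʳ i | nCn≡1 (suc i) = refl
binomial-mod-2 (suc i) (suc j) = begin
  (suc (i ℕ.+ suc j) C suc i) % 2
    ≡⟨ cong (_% 2) (sym (nCk+nC[k+1]≡[n+1]C[k+1] (i ℕ.+ suc j) i)) ⟩
  ((i ℕ.+ suc j) C i ℕ.+ (i ℕ.+ suc j) C suc i) % 2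
    ≡⟨ cong (λ n → ((i ℕ.+ suc j) C i ℕ.+ n C suc i) % 2) (ℕP.+-suc i j) ⟩
  ((i ℕ.+ suc j) C i ℕ.+ (suc i ℕ.+ j) C suc i) % 2
    ≡⟨ %-distribˡ-+ ((i ℕ.+ suc j) C i) ((suc i ℕ.+ j) C suc i) 2 ⟩
  (((i ℕ.+ suc j) C i) % 2 ℕ.+ ((suc i ℕ.+ j) C suc i) % 2) % 2
    ≡⟨ cong₂ (λ a b → (a ℕ.+ b) % 2) (binomial-mod-2 i (suc j)) (binomial-mod-2 (suc i) j) ⟩
  (bit (pascal₂ i (suc j)) ℕ.+ bit (pascal₂ (suc i) j)) % 2
    ≡⟨ sym (bit-xor (pascal₂ i (suc j)) (pascal₂ (suc i) j)) ⟩
  bit (pascal₂ (suc i) (suc j)) ∎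

P≡pascal₂ : ∀ i j → P i j ≡ + bit (pascal₂ i j)
P≡pascal₂ i j rewrite binomial-mod-2 i j with pascal₂ i j
... | true  = refl
... | false = refl

-- Lucas' theorem modulo 2, by simultaneous induction along Pascal's rule.
pascal₂-even-even : ∀ i j → pascal₂ (double i) (double j) ≡ pascal₂ i j
pascal₂-even-odd  : ∀ i j → pascal₂ (double i) (suc (double j)) ≡ pascal₂ i j
pascal₂-odd-even  : ∀ i j → pascal₂ (suc (double i)) (double j) ≡ pascal₂ i j
pascal₂-odd-odd   : ∀ i j → pascal₂ (suc (double i)) (suc (double j)) ≡ false

pascal₂-even-even zero    j       = refl
pascal₂-even-even (suc i) zero    = refl
pascal₂-even-even (suc i) (suc j)
  rewrite pascal₂-odd-even i (suc j) | pascal₂-even-odd (suc i) j = refl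
pascal₂-even-odd zero    j = refl
pascal₂-even-odd (suc i) j
  rewrite pascal₂-odd-odd i j | pascal₂-even-even (suc i) j = refl
pascal₂-odd-even zero    zero    = refl
pascal₂-odd-even (suc i) zero    = refl
pascal₂-odd-even i       (suc j)
  rewrite pascal₂-even-even i (suc j) | pascal₂-odd-odd i j = xor-identityʳ (pascal₂ i (suc j))
pascal₂-odd-odd i j
  rewrite pascal₂-even-odd i j | pascal₂-odd-even i j = xor-same (pascal₂ i j)

P-cong : ∀ i j i′ j′ → pascal₂ i j ≡ pascal₂ i′ j′ → P i j ≡ P i′ j′
P-cong i j i′ j′ eq = trans (P≡pascal₂ i j) (trans (cong (+_ ∘ bit) eq) (sym (P≡pascal₂ i′ j′)))

P-evenRow-evenColumn : ∀ x w → P (double x) (double w) ≡ P x w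
P-evenRow-evenColumn x w = P-cong (double x) (double w) x w (pascal₂-even-even x w)

P-oddRow-evenColumn : ∀ x w → P (suc (double x)) (double w) ≡ P x w
P-oddRow-evenColumn x w = P-cong (suc (double x)) (double w) x w (pascal₂-odd-even x w)

P-evenRow-oddColumn : ∀ x w → P (double x) (suc (double w)) ≡ P x w
P-evenRow-oddColumn x w = P-cong (double x) (suc (double w)) x w (pascal₂-even-odd x w)

P-oddRow-oddColumn : ∀ x w → P (suc (double x)) (suc (double w)) ≡ + 0
P-oddRow-oddColumn x w =
  trans (P≡pascal₂ (suc (double x)) (suc (double w))) (cong (+_ ∘ bit) (pascal₂-odd-odd x w))

P-evenColumn : ∀ r w → P r (double w) ≡ P ⌊ r /2⌋ w
P-evenColumn r w with halving r
... | even x rewrite ⌊double/2⌋ x     = P-evenRow-evenColumn x w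
... | odd x  rewrite ⌊suc-double/2⌋ x = P-oddRow-evenColumn x w

P-evenColumn-pair : ∀ x w → P (double x) (double w) - P (suc (double x)) (double w) ≡ + 0
P-evenColumn-pair x w = begin
  P (double x) (double w) - P (suc (double x)) (double w)
    ≡⟨ cong₂ _-_ (P-evenRow-evenColumn x w) (P-oddRow-evenColumn x w) ⟩
  P x w - P x w
    ≡⟨ ℤP.+-inverseʳ (P x w) ⟩
  + 0 ∎

-- The blocks of P_m(n)

evensLeft : ∀ k → Shuffle (double k) k k
evensLeft zero    = []
evensLeft (suc k) = left (right (evensLeft k))

oddsLeft : ∀ k → Shuffle (double k) k k
oddsLeft zero    = []
oddsLeft (suc k) = right (left (oddsLeft k))

-- The last position 2k has no partner 2k + 1, so it is a right position.
evensLeft⁺ : ∀ k → Shuffle (suc (double k)) k (suc k)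
evensLeft⁺ zero    = right []
evensLeft⁺ (suc k) = left (right (evensLeft⁺ k))

oddsLeft⁺ : ∀ k → Shuffle (suc (double k)) k (suc k)
oddsLeft⁺ zero    = right []
oddsLeft⁺ (suc k) = right (left (oddsLeft⁺ k))

toℕ-lefts-evensLeft : ∀ k i → toℕ (lefts (evensLeft k) i) ≡ double (toℕ i)
toℕ-lefts-evensLeft (suc k) zero    = refl
toℕ-lefts-evensLeft (suc k) (suc i) = cong (λ x → suc (suc x)) (toℕ-lefts-evensLeft k i)

toℕ-rights-evensLeft : ∀ k i → toℕ (rights (evensLeft k) i) ≡ suc (double (toℕ i))
toℕ-rights-evensLeft (suc k) zero    = refl
toℕ-rights-evensLeft (suc k) (suc i) = cong (λ x → suc (suc x)) (toℕ-rights-evensLeft k i)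

toℕ-lefts-oddsLeft : ∀ k i → toℕ (lefts (oddsLeft k) i) ≡ suc (double (toℕ i))
toℕ-lefts-oddsLeft (suc k) zero    = refl
toℕ-lefts-oddsLeft (suc k) (suc i) = cong (λ x → suc (suc x)) (toℕ-lefts-oddsLeft k i)

toℕ-rights-oddsLeft : ∀ k i → toℕ (rights (oddsLeft k) i) ≡ double (toℕ i)
toℕ-rights-oddsLeft (suc k) zero    = refl
toℕ-rights-oddsLeft (suc k) (suc i) = cong (λ x → suc (suc x)) (toℕ-rights-oddsLeft k i)

toℕ-lefts-evensLeft⁺ : ∀ k i → toℕ (lefts (evensLeft⁺ k) i) ≡ double (toℕ i)
toℕ-lefts-evensLeft⁺ (suc k) zero    = refl
toℕ-lefts-evensLeft⁺ (suc k) (suc i) = cong (λ x → suc (suc x)) (toℕ-lefts-evensLeft⁺ k i)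

⌊toℕ-rights-evensLeft⁺/2⌋ : ∀ k i → ⌊ toℕ (rights (evensLeft⁺ k) i) /2⌋ ≡ toℕ i
⌊toℕ-rights-evensLeft⁺/2⌋ zero    zero    = refl
⌊toℕ-rights-evensLeft⁺/2⌋ (suc k) zero    = refl
⌊toℕ-rights-evensLeft⁺/2⌋ (suc k) (suc i) = cong suc (⌊toℕ-rights-evensLeft⁺/2⌋ k i)

toℕ-lefts-oddsLeft⁺ : ∀ k i → toℕ (lefts (oddsLeft⁺ k) i) ≡ suc (double (toℕ i))
toℕ-lefts-oddsLeft⁺ (suc k) zero    = refl
toℕ-lefts-oddsLeft⁺ (suc k) (suc i) = cong (λ x → suc (suc x)) (toℕ-lefts-oddsLeft⁺ k i)

toℕ-rights-oddsLeft⁺ : ∀ k i → toℕ (rights (oddsLeft⁺ k) i) ≡ double (toℕ i)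
toℕ-rights-oddsLeft⁺ zero    zero    = refl
toℕ-rights-oddsLeft⁺ (suc k) zero    = refl
toℕ-rights-oddsLeft⁺ (suc k) (suc i) = cong (λ x → suc (suc x)) (toℕ-rights-oddsLeft⁺ k i)

pairDiff-oddEntriesZero : ∀ {n} (v : ℕ → ℤ) → (∀ x → v (suc (double x)) ≡ + 0) →
  ∀ (r : Fin n) → pairDiff (v ∘ toℕ) r ≡ v (toℕ r)
pairDiff-oddEntriesZero {suc zero}    v v-odd≡0 r = refl
pairDiff-oddEntriesZero {suc (suc n)} v v-odd≡0 zero =
  trans (cong (λ x → v 0 - x) (v-odd≡0 0)) (ℤP.+-identityʳ (v 0))
pairDiff-oddEntriesZero {suc (suc n)} v v-odd≡0 (suc zero) = refl
pairDiff-oddEntriesZero {suc (suc n)} v v-odd≡0 (suc (suc r)) =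
  pairDiff-oddEntriesZero (λ x → v (suc (suc x))) (λ x → v-odd≡0 (suc x)) r

pairDiff-lefts-evensLeft : ∀ k (v : ℕ → ℤ) i →
  pairDiff (v ∘ toℕ) (lefts (evensLeft k) i) ≡ v (double (toℕ i)) - v (suc (double (toℕ i)))
pairDiff-lefts-evensLeft (suc k) v zero    = refl
pairDiff-lefts-evensLeft (suc k) v (suc i) = pairDiff-lefts-evensLeft k (λ x → v (suc (suc x))) i

pairDiff-rights-evensLeft : ∀ k (v : ℕ → ℤ) i →
  pairDiff (v ∘ toℕ) (rights (evensLeft k) i) ≡ v (suc (double (toℕ i)))
pairDiff-rights-evensLeft (suc k) v zero    = refl
pairDiff-rights-evensLeft (suc k) v (suc i) = pairDiff-rights-evensLeft k (λ x → v (suc (suc x))) i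

pairDiff-lefts-evensLeft⁺ : ∀ k (v : ℕ → ℤ) i →
  pairDiff (v ∘ toℕ) (lefts (evensLeft⁺ k) i) ≡ v (double (toℕ i)) - v (suc (double (toℕ i)))
pairDiff-lefts-evensLeft⁺ (suc k) v zero    = refl
pairDiff-lefts-evensLeft⁺ (suc k) v (suc i) = pairDiff-lefts-evensLeft⁺ k (λ x → v (suc (suc x))) i

pairDiff-rights-evensLeft⁺ : ∀ k (v : ℕ → ℤ) i →
  pairDiff (v ∘ toℕ) (rights (evensLeft⁺ k) i) ≡ v (toℕ (rights (evensLeft⁺ k) i))
pairDiff-rights-evensLeft⁺ zero    v zero    = refl
pairDiff-rights-evensLeft⁺ (suc k) v zero    = refl
pairDiff-rights-evensLeft⁺ (suc k) v (suc i) = pairDiff-rights-evensLeft⁺ k (λ x → v (suc (suc x))) i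

pairDiff-lefts-oddsLeft⁺ : ∀ k (v : ℕ → ℤ) i →
  pairDiff (v ∘ toℕ) (lefts (oddsLeft⁺ k) i) ≡ v (suc (double (toℕ i)))
pairDiff-lefts-oddsLeft⁺ (suc k) v zero    = refl
pairDiff-lefts-oddsLeft⁺ (suc k) v (suc i) = pairDiff-lefts-oddsLeft⁺ k (λ x → v (suc (suc x))) i

pairDiff-oddColumn : ∀ {n} w (r : Fin n) →
  pairDiff (λ r′ → P (toℕ r′) (suc (double w))) r ≡ P (toℕ r) (suc (double w))
pairDiff-oddColumn w = pairDiff-oddEntriesZero (λ x → P x (suc (double w))) (λ x → P-oddRow-oddColumn x w)

Psub-unimodular-even-even : ∀ a k → Unimodular (Psub a k) → Unimodular (Psub (double a) (double k))
Psub-unimodular-even-even a k unimodular =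
  unimodular-pairDiffRows (Psub (double a) (double k))
  (unimodular-zeroBlock (evensLeft k) (oddsLeft k) R zeroBlock leftBlock rightBlock unimodular unimodular)
  where
  R : Matrix (double k)
  R = pairDiffRows (Psub (double a) (double k))
  zeroBlock : ZeroBlock (evensLeft k) (oddsLeft k) R
  zeroBlock i j rewrite toℕ-rights-oddsLeft k j | double-+-double a (toℕ j) =
    trans (pairDiff-lefts-evensLeft k (λ x → P x (double (a ℕ.+ toℕ j))) i)
          (P-evenColumn-pair (toℕ i) (a ℕ.+ toℕ j))
  leftBlock : ∀ i j → R (lefts (evensLeft k) i) (lefts (oddsLeft k) j) ≡ Psub a k i j
  leftBlock i j rewrite toℕ-lefts-oddsLeft k j | double-+-suc-double a (toℕ j) =
    trans (pairDiff-oddColumn (a ℕ.+ toℕ j) (lefts (evensLeft k) i))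
          (trans (cong (λ r → P r (suc (double (a ℕ.+ toℕ j)))) (toℕ-lefts-evensLeft k i))
                 (P-evenRow-oddColumn (toℕ i) (a ℕ.+ toℕ j)))
  rightBlock : ∀ i j → R (rights (evensLeft k) i) (rights (oddsLeft k) j) ≡ Psub a k i j
  rightBlock i j rewrite toℕ-rights-oddsLeft k j | double-+-double a (toℕ j) =
    trans (pairDiff-rights-evensLeft k (λ x → P x (double (a ℕ.+ toℕ j))) i)
          (P-oddRow-evenColumn (toℕ i) (a ℕ.+ toℕ j))

Psub-unimodular-odd-even : ∀ a k → Unimodular (Psub a k) → Unimodular (Psub (suc a) k) →
  Unimodular (Psub (suc (double a)) (double k))
Psub-unimodular-odd-even a k unimodular unimodular′ =
  unimodular-pairDiffRows (Psub (suc (double a)) (double k))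
  (unimodular-zeroBlock (evensLeft k) (evensLeft k) R zeroBlock leftBlock rightBlock unimodular unimodular′)
  where
  R : Matrix (double k)
  R = pairDiffRows (Psub (suc (double a)) (double k))
  zeroBlock : ZeroBlock (evensLeft k) (evensLeft k) R
  zeroBlock i j rewrite toℕ-rights-evensLeft k j | suc-double-+-suc-double a (toℕ j) =
    trans (pairDiff-lefts-evensLeft k (λ x → P x (double (suc (a ℕ.+ toℕ j)))) i)
          (P-evenColumn-pair (toℕ i) (suc (a ℕ.+ toℕ j)))
  leftBlock : ∀ i j → R (lefts (evensLeft k) i) (lefts (evensLeft k) j) ≡ Psub a k i j
  leftBlock i j rewrite toℕ-lefts-evensLeft k j | suc-double-+-double a (toℕ j) =
    trans (pairDiff-oddColumn (a ℕ.+ toℕ j) (lefts (evensLeft k) i))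
          (trans (cong (λ r → P r (suc (double (a ℕ.+ toℕ j)))) (toℕ-lefts-evensLeft k i))
                 (P-evenRow-oddColumn (toℕ i) (a ℕ.+ toℕ j)))
  rightBlock : ∀ i j → R (rights (evensLeft k) i) (rights (evensLeft k) j) ≡ Psub (suc a) k i j
  rightBlock i j rewrite toℕ-rights-evensLeft k j | suc-double-+-suc-double a (toℕ j) =
    trans (pairDiff-rights-evensLeft k (λ x → P x (double (suc (a ℕ.+ toℕ j)))) i)
          (P-oddRow-evenColumn (toℕ i) (suc (a ℕ.+ toℕ j)))

Psub-unimodular-even-odd : ∀ a k → Unimodular (Psub a k) → Unimodular (Psub a (suc k)) →
  Unimodular (Psub (double a) (suc (double k)))
Psub-unimodular-even-odd a k unimodular unimodular′ =
  unimodular-pairDiffRows (Psub (double a) (suc (double k)))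
  (unimodular-zeroBlock (evensLeft⁺ k) (oddsLeft⁺ k) R zeroBlock leftBlock rightBlock unimodular unimodular′)
  where
  R : Matrix (suc (double k))
  R = pairDiffRows (Psub (double a) (suc (double k)))
  zeroBlock : ZeroBlock (evensLeft⁺ k) (oddsLeft⁺ k) R
  zeroBlock i j rewrite toℕ-rights-oddsLeft⁺ k j | double-+-double a (toℕ j) =
    trans (pairDiff-lefts-evensLeft⁺ k (λ x → P x (double (a ℕ.+ toℕ j))) i)
          (P-evenColumn-pair (toℕ i) (a ℕ.+ toℕ j))
  leftBlock : ∀ i j → R (lefts (evensLeft⁺ k) i) (lefts (oddsLeft⁺ k) j) ≡ Psub a k i j
  leftBlock i j rewrite toℕ-lefts-oddsLeft⁺ k j | double-+-suc-double a (toℕ j) =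
    trans (pairDiff-oddColumn (a ℕ.+ toℕ j) (lefts (evensLeft⁺ k) i))
          (trans (cong (λ r → P r (suc (double (a ℕ.+ toℕ j)))) (toℕ-lefts-evensLeft⁺ k i))
                 (P-evenRow-oddColumn (toℕ i) (a ℕ.+ toℕ j)))
  rightBlock : ∀ i j → R (rights (evensLeft⁺ k) i) (rights (oddsLeft⁺ k) j) ≡ Psub a (suc k) i j
  rightBlock i j rewrite toℕ-rights-oddsLeft⁺ k j | double-+-double a (toℕ j) =
    trans (pairDiff-rights-evensLeft⁺ k (λ x → P x (double (a ℕ.+ toℕ j))) i)
          (trans (P-evenColumn (toℕ (rights (evensLeft⁺ k) i)) (a ℕ.+ toℕ j))
                 (cong (λ x → P x (a ℕ.+ toℕ j)) (⌊toℕ-rights-evensLeft⁺/2⌋ k i)))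

Psub-unimodular-odd-odd : ∀ a k → Unimodular (Psub (suc a) k) → Unimodular (Psub a (suc k)) →
  Unimodular (Psub (suc (double a)) (suc (double k)))
Psub-unimodular-odd-odd a k unimodular unimodular′ =
  unimodular-pairDiffRows (Psub (suc (double a)) (suc (double k)))
  (unimodular-zeroBlock (oddsLeft⁺ k) (oddsLeft⁺ k) R zeroBlock leftBlock rightBlock unimodular unimodular′)
  where
  R : Matrix (suc (double k))
  R = pairDiffRows (Psub (suc (double a)) (suc (double k)))
  zeroBlock : ZeroBlock (oddsLeft⁺ k) (oddsLeft⁺ k) R
  zeroBlock i j rewrite toℕ-rights-oddsLeft⁺ k j | suc-double-+-double a (toℕ j) =
    trans (pairDiff-oddColumn (a ℕ.+ toℕ j) (lefts (oddsLeft⁺ k) i))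
          (trans (cong (λ r → P r (suc (double (a ℕ.+ toℕ j)))) (toℕ-lefts-oddsLeft⁺ k i))
                 (P-oddRow-oddColumn (toℕ i) (a ℕ.+ toℕ j)))
  leftBlock : ∀ i j → R (lefts (oddsLeft⁺ k) i) (lefts (oddsLeft⁺ k) j) ≡ Psub (suc a) k i j
  leftBlock i j rewrite toℕ-lefts-oddsLeft⁺ k j | suc-double-+-suc-double a (toℕ j) =
    trans (pairDiff-lefts-oddsLeft⁺ k (λ x → P x (double (suc (a ℕ.+ toℕ j)))) i)
          (P-oddRow-evenColumn (toℕ i) (suc (a ℕ.+ toℕ j)))
  rightBlock : ∀ i j → R (rights (oddsLeft⁺ k) i) (rights (oddsLeft⁺ k) j) ≡ Psub a (suc k) i j
  rightBlock i j rewrite toℕ-rights-oddsLeft⁺ k j | suc-double-+-double a (toℕ j) =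
    trans (pairDiff-oddColumn (a ℕ.+ toℕ j) (rights (oddsLeft⁺ k) i))
          (trans (cong (λ r → P r (suc (double (a ℕ.+ toℕ j)))) (toℕ-rights-oddsLeft⁺ k i))
                 (P-evenRow-oddColumn (toℕ i) (a ℕ.+ toℕ j)))

k≤double : ∀ k → k ℕ.≤ double k
k≤double zero    = z≤n
k≤double (suc k) = s≤s (ℕP.m≤n⇒m≤1+n (k≤double k))

1+k<double[1+k] : ∀ k → suc k ℕ.< double (suc k)
1+k<double[1+k] k = s≤s (s≤s (k≤double k))

2+k<1+double[1+k] : ∀ k → suc (suc k) ℕ.< suc (double (suc k))
2+k<1+double[1+k] k = s≤s (1+k<double[1+k] k)

1+k<1+double[1+k] : ∀ k → suc k ℕ.< suc (double (suc k))
1+k<1+double[1+k] k = ℕP.<-trans (ℕP.n<1+n (suc k)) (2+k<1+double[1+k] k)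

Psub-unimodular-0 : ∀ m → Unimodular (Psub m 0)
Psub-unimodular-0 m = refl

-- The 1 × 1 determinant unfolds to + 1 * (P 0 m * + 1) + + 0.
Psub-unimodular-1 : ∀ m → Unimodular (Psub m 1)
Psub-unimodular-1 m = cong (λ x → ∣ + 1 * (x * + 1) + + 0 ∣) (P≡pascal₂ 0 (m ℕ.+ 0))

Psub-unimodular-step : ∀ {n m} → Halving n → Halving m →
  (∀ {n′} → n′ ℕ.< n → ∀ m′ → Unimodular (Psub m′ n′)) → Unimodular (Psub m n)
Psub-unimodular-step {m = m} (even zero) _ _ = Psub-unimodular-0 m
Psub-unimodular-step {m = m} (odd zero)  _ _ = Psub-unimodular-1 m
Psub-unimodular-step (even (suc k)) (even a) IH =
  Psub-unimodular-even-even a (suc k) (IH (1+k<double[1+k] k) a)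
Psub-unimodular-step (even (suc k)) (odd a) IH =
  Psub-unimodular-odd-even a (suc k) (IH (1+k<double[1+k] k) a) (IH (1+k<double[1+k] k) (suc a))
Psub-unimodular-step (odd (suc k)) (even a) IH =
  Psub-unimodular-even-odd a (suc k) (IH (1+k<1+double[1+k] k) a) (IH (2+k<1+double[1+k] k) a)
Psub-unimodular-step (odd (suc k)) (odd a) IH =
  Psub-unimodular-odd-odd a (suc k) (IH (1+k<1+double[1+k] k) (suc a)) (IH (2+k<1+double[1+k] k) a)

Psub-unimodular : ∀ n m → Unimodular (Psub m n)
Psub-unimodular = <-rec (λ n → ∀ m → Unimodular (Psub m n))
  (λ n IH m → Psub-unimodular-step (halving n) (halving m) IH)

∣i∣≡1⇒i≡±1 : ∀ {i} → ∣ i ∣ ≡ 1 → i ≡ + 1 ⊎ i ≡ - (+ 1)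
∣i∣≡1⇒i≡±1 {+ _}      refl = inj₁ refl
∣i∣≡1⇒i≡±1 { -[1+ _ ]} refl = inj₂ refl

corollary1 : (n m : ℕ) → det (Psub m n) ≡ + 1 ⊎ det (Psub m n) ≡ - (+ 1)
corollary1 n m = ∣i∣≡1⇒i≡±1 (Psub-unimodular n m)
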